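{- Let $G$ be a finite simple undirected graph with $s$ vertices and $t$ edges, let $m\ge 1$, and let $\overline{K}_m$ denote the edgeless graph on $m$ vertices. Then $$Mo(G\circ \overline{K}_m)\le (m+1)\,Mo(G)+sm\,|2-s-sm| .$$
   Context: For a graph $X$ and an edge $e=uv$ of $X$, $n_u(e\mid X)$ denotes the number of vertices $w$ of $X$ with $d_X(w,u)<d_X(w,v)$ ($d_X$ the shortest-path distance). The Mostar index is $Mo(X)=\sum_{uv\in E(X)}|n_u(e\mid X)-n_v(e\mid X)|$. The corona product $G\circ H$ (with $G$ on $s$ vertices) is obtained from one copy of $G$ and $s$ disjoint copies of $H$ by joining the $g$-th vertex of $G$ to every vertex of the $g$-th copy of $H$. Thus $G\circ\overline{K}_m$ is obtained by attaching $m$ pendant vertices to each vertex of $G$. -}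

module Defs where

open import Data.Nat using (ℕ; zero; suc; _+_; _*_; _<ᵇ_; ∣_-_∣)
open import Data.Bool using (Bool; true; false; _∧_; _∨_; if_then_else_)
open import Data.Fin using (Fin; toℕ; splitAt; remQuot; _≟_)
open import Data.Fin.Properties using ()
open import Data.List using (List; map)
open import Data.Nat.ListAction using (sum)
open import Data.Bool.ListAction using (any)
open import Data.List.Base using (allFin)
open import Data.Maybe using (Maybe; just; nothing)
open import Data.Sum using (_⊎_; inj₁; inj₂)
open import Data.Product using (proj₁)
open import Relation.Nullary.Decidable using (⌊_⌋; yes; no)
open import Data.Empty using (⊥-elim)
open import Relation.Binary.PropositionalEquality using (_≡_; refl; sym)

record Graph : Set where
  field
    order  : ℕ
    adj    : Fin order → Fin order → Bool
    adj-sym   : ∀ i j → adj i j ≡ adj j i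
    adj-irrefl : ∀ i → adj i i ≡ false
open Graph public

reach : (G : Graph) → ℕ → Fin (order G) → Fin (order G) → Bool
reach G zero    u w = ⌊ u ≟ w ⌋
reach G (suc k) u w = reach G k u w ∨ any (λ x → reach G k u x ∧ adj G x w) (allFin (order G))

-- shortest-path distance; nothing = infinite (different components).
-- A shortest path has length < order G, so searching k = 0 .. order G - 1 suffices.
distFrom : (G : Graph) → ℕ → ℕ → Fin (order G) → Fin (order G) → Maybe ℕ
distFrom G k zero    u w = nothing
distFrom G k (suc r) u w = if reach G k u w then just k else distFrom G (suc k) r u w

dist : (G : Graph) → Fin (order G) → Fin (order G) → Maybe ℕ
dist G u w = distFrom G 0 (order G) u w

infix 4 _<∞_
_<∞_ : Maybe ℕ → Maybe ℕ → Bool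
just a  <∞ just b  = a <ᵇ b
just a  <∞ nothing = true
nothing <∞ _       = false

nClose : (G : Graph) → Fin (order G) → Fin (order G) → ℕ
nClose G u v = sum (map (λ w → if dist G w u <∞ dist G w v then 1 else 0) (allFin (order G)))

mostar : Graph → ℕ
mostar G = sum (map (λ i → sum (map (λ j →
             if (toℕ i <ᵇ toℕ j) ∧ adj G i j
             then ∣ nClose G i j - nClose G j i ∣ else 0)
           (allFin (order G)))) (allFin (order G)))

-- Corona G ∘ K̄_m: vertices Fin (s + s * m); inj₁ g is vertex g of G,
-- inj₂ p with remQuot p = (g , k) is the k-th pendant vertex attached to g.
coronaAdj : (G : Graph) (m : ℕ) → Fin (order G + order G * m) → Fin (order G + order G * m) → Bool
coronaAdj G m x y with splitAt (order G) x | splitAt (order G) y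
... | inj₁ g | inj₁ h = adj G g h
... | inj₁ g | inj₂ p = ⌊ g ≟ proj₁ (remQuot m p) ⌋
... | inj₂ p | inj₁ h = ⌊ proj₁ (remQuot m p) ≟ h ⌋
... | inj₂ p | inj₂ q = false

coronaAdj-sym : (G : Graph) (m : ℕ) → ∀ x y → coronaAdj G m x y ≡ coronaAdj G m y x
coronaAdj-sym G m x y with splitAt (order G) x | splitAt (order G) y
... | inj₁ g | inj₁ h = adj-sym G g h
... | inj₁ g | inj₂ p with g ≟ proj₁ (remQuot m p) | proj₁ (remQuot m p) ≟ g
...   | yes _ | yes _ = refl
...   | no _  | no _  = refl
...   | yes e | no ne = ⊥-elim (ne (sym e))
...   | no ne | yes e = ⊥-elim (ne (sym e))
coronaAdj-sym G m x y | inj₂ p | inj₁ h with proj₁ (remQuot m p) ≟ h | h ≟ proj₁ (remQuot m p)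
...   | yes _ | yes _ = refl
...   | no _  | no _  = refl
...   | yes e | no ne = ⊥-elim (ne (sym e))
...   | no ne | yes e = ⊥-elim (ne (sym e))
coronaAdj-sym G m x y | inj₂ p | inj₂ q = refl

coronaAdj-irrefl : (G : Graph) (m : ℕ) → ∀ x → coronaAdj G m x x ≡ false
coronaAdj-irrefl G m x with splitAt (order G) x
... | inj₁ g = adj-irrefl G g
... | inj₂ p = refl

coronaEmpty : Graph → ℕ → Graph
coronaEmpty G m = record
  { order = order G + order G * m
  ; adj = coronaAdj G m
  ; adj-sym = coronaAdj-sym G m
  ; adj-irrefl = coronaAdj-irrefl G m }

-- In G ∘ K̄ₘ every vertex x lies over an anchor in G (itself, or the vertex its pendant is
-- attached to) at depth 0 or 1, and d(x, u) = depth x + d_G(anchor x, u) for every vertex u of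
-- G. So for an edge gh of G each of the m + 1 vertices over w is closer to g than to h exactly
-- when w is, and gh contributes (m + 1)|n_g − n_h|. Each of the s·m pendant edges contributes at
-- most n − 2 ≤ |2 − n|, n = s + sm, because the ends of any edge uv satisfy 1 ≤ n_u, n_v ≤ n − 1.
module Submission where

open import Data.Bool.Base using (Bool; true; false; T; _∧_; _∨_; if_then_else_)
open import Data.Bool.ListAction using (or)
open import Data.Bool.Properties using (T-∧; T-∨; if-float; if-cong-else) renaming (_≟_ to _≟ᴮ_)
open import Data.Empty using (⊥)
open import Data.Fin.Base using (Fin; zero; suc; toℕ; splitAt; join; quotient; punchIn; _↑ˡ_; _↑ʳ_)
open import Data.Fin.Properties
  using (_≟_; punchInᵢ≢i; splitAt-↑ˡ; splitAt-↑ʳ; splitAt-join; toℕ-↑ˡ; toℕ-↑ʳ; toℕ<n; nonZeroIndex; all?; ¬∀⟶∃¬)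
open import Data.List.Base using (map; allFin; tabulate)
open import Data.List.Membership.Propositional using (lose)
open import Data.List.Membership.Propositional.Properties using (∈-allFin)
open import Data.List.Properties using (map-tabulate; map-cong)
open import Data.List.Relation.Unary.Any using (satisfied)
open import Data.List.Relation.Unary.Any.Properties using (any⁺; any⁻)
open import Data.Maybe.Base as Maybe using (Maybe; just; nothing)
open import Data.Nat.Base using (ℕ; zero; suc; pred; _+_; _*_; _∸_; _≤_; _<_; _<ᵇ_; z≤n; s≤s; ∣_-_∣)
open import Data.Nat.ListAction as List using ()
open import Data.Nat.Properties hiding (_≟_)
open import Data.Product.Base using (∃-syntax; _×_; _,_; proj₂)
open import Data.Sum.Base using (_⊎_; inj₁; inj₂; [_,_]′)
open import Function.Base using (_∘_; id; case_of_)
open import Function.Bundles using (Equivalence)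
open import Relation.Binary.PropositionalEquality
open import Relation.Nullary.Decidable using (⌊_⌋; yes; no; toWitness; fromWitness)
open import Relation.Nullary.Negation using (¬_; contradiction)

open import Defs
open import Algebra.Properties.Semiring.Sum +-*-semiring
  using (sum; sum-cong-≗; sum-remove; sum-replicate-zero; ∑-distrib-+; *-distribˡ-sum)

sum-tabulate : ∀ {n} (f : Fin n → ℕ) → List.sum (tabulate f) ≡ sum f
sum-tabulate {zero}  f = refl
sum-tabulate {suc n} f = cong (f zero +_) (sum-tabulate (f ∘ suc))

sum-allFin : ∀ {n} (f : Fin n → ℕ) → List.sum (map f (allFin n)) ≡ sum f
sum-allFin f = trans (cong List.sum (map-tabulate id f)) (sum-tabulate f)

sum-mono-≤ : ∀ {n} {f g : Fin n → ℕ} → (∀ i → f i ≤ g i) → sum f ≤ sum g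
sum-mono-≤ {zero}  f≤g = z≤n
sum-mono-≤ {suc n} f≤g = +-mono-≤ (f≤g zero) (sum-mono-≤ (f≤g ∘ suc))

sum-mono-< : ∀ {n} {f g : Fin n → ℕ} → (∀ i → f i ≤ g i) → ∀ i → f i < g i → sum f < sum g
sum-mono-< {suc n} {f} {g} f≤g i fi<gi = begin-strict
  sum f                         ≡⟨ sum-remove f ⟩
  f i + sum (f ∘ punchIn i)     <⟨ +-mono-<-≤ fi<gi (sum-mono-≤ (f≤g ∘ punchIn i)) ⟩
  g i + sum (g ∘ punchIn i)     ≡⟨ sum-remove g ⟨
  sum g                         ∎
  where open ≤-Reasoning

≤-sum : ∀ {n} (f : Fin n → ℕ) i → f i ≤ sum f
≤-sum {suc n} f i = begin
  f i                       ≤⟨ m≤m+n (f i) _ ⟩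
  f i + sum (f ∘ punchIn i) ≡⟨ sum-remove f ⟨
  sum f                     ∎
  where open ≤-Reasoning

sum-const : ∀ {n} c → sum {n} (λ _ → c) ≡ n * c
sum-const {zero}  c = refl
sum-const {suc n} c = cong (c +_) (sum-const {n} c)

sum-single : ∀ {n} (f : Fin n → ℕ) i → (∀ j → j ≢ i → f j ≡ 0) → sum f ≡ f i
sum-single {suc n} f i f≡0 = begin
  sum f                      ≡⟨ sum-remove f ⟩
  f i + sum (f ∘ punchIn i)  ≡⟨ cong (f i +_) (sum-cong-≗ (λ j → f≡0 _ (punchInᵢ≢i i j))) ⟩
  f i + sum {n} (λ _ → 0)    ≡⟨ cong (f i +_) (sum-replicate-zero n) ⟩
  f i + 0                    ≡⟨ +-identityʳ (f i) ⟩
  f i                        ∎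
  where open ≡-Reasoning

sum-zero : ∀ {n} {f : Fin n → ℕ} → (∀ i → f i ≡ 0) → sum f ≡ 0
sum-zero {n} f≡0 = trans (sum-cong-≗ f≡0) (sum-replicate-zero n)

sum-if-≟ : ∀ {n} (i : Fin n) c → sum (λ j → if ⌊ i ≟ j ⌋ then c else 0) ≡ c
sum-if-≟ i c = trans (sum-single (λ j → if ⌊ i ≟ j ⌋ then c else 0) i vanish) (on-diagonal i)
  where
  vanish : ∀ j → j ≢ i → (if ⌊ i ≟ j ⌋ then c else 0) ≡ 0
  vanish j j≢i with i ≟ j
  ... | yes i≡j = contradiction (sym i≡j) j≢i
  ... | no  _   = refl
  on-diagonal : ∀ i → (if ⌊ i ≟ i ⌋ then c else 0) ≡ c
  on-diagonal i with i ≟ i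
  ... | yes _   = refl
  ... | no  i≢i = contradiction refl i≢i

sum-↑ : ∀ a {b} (f : Fin (a + b) → ℕ) → sum f ≡ sum (f ∘ (_↑ˡ b)) + sum (f ∘ (a ↑ʳ_))
sum-↑ zero    f = refl
sum-↑ (suc a) f = trans (cong (f zero +_) (sum-↑ a (f ∘ suc))) (sym (+-assoc (f zero) _ _))

sum-quotient : ∀ s m (f : Fin s → ℕ) → sum {s * m} (f ∘ quotient m) ≡ m * sum f
sum-quotient zero    m f = sym (*-zeroʳ m)
sum-quotient (suc s) m f = begin
  sum {suc s * m} (f ∘ quotient m)
    ≡⟨ sum-↑ m (f ∘ quotient m) ⟩
  sum (f ∘ quotient {suc s} m ∘ (_↑ˡ (s * m))) + sum (f ∘ quotient {suc s} m ∘ (m ↑ʳ_))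
    ≡⟨ cong₂ _+_ (sum-cong-≗ (cong f ∘ quotient-↑ˡ)) (sum-cong-≗ (cong f ∘ quotient-↑ʳ)) ⟩
  sum {m} (λ _ → f zero) + sum (f ∘ suc ∘ quotient {s} m)
    ≡⟨ cong₂ _+_ (sum-const {m} (f zero)) (sum-quotient s m (f ∘ suc)) ⟩
  m * f zero + m * sum (f ∘ suc)
    ≡⟨ *-distribˡ-+ m (f zero) _ ⟨
  m * sum f ∎
  where
  open ≡-Reasoning
  quotient-↑ˡ : ∀ i → quotient {suc s} m (i ↑ˡ (s * m)) ≡ zero
  quotient-↑ˡ i rewrite splitAt-↑ˡ m i (s * m) = refl
  quotient-↑ʳ : ∀ j → quotient {suc s} m (m ↑ʳ j) ≡ suc (quotient {s} m j)
  quotient-↑ʳ j rewrite splitAt-↑ʳ m (s * m) j = refl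

indicator : Bool → ℕ
indicator b = if b then 1 else 0

indicator≤1 : ∀ b → indicator b ≤ 1
indicator≤1 false = z≤n
indicator≤1 true  = ≤-refl

indicator-mono : ∀ {a b} → (T a → T b) → indicator a ≤ indicator b
indicator-mono {false} _   = z≤n
indicator-mono {true} {false} a⇒b = contradiction (a⇒b _) id
indicator-mono {true} {true}  _   = ≤-refl

indicator-mono-< : ∀ {a b} → (T a → T b) → a ≢ b → indicator a < indicator b
indicator-mono-< {false} {false} _ a≢b = contradiction refl a≢b
indicator-mono-< {false} {true}  _ _   = ≤-refl
indicator-mono-< {true}  {false} a⇒b _ = contradiction (a⇒b _) id
indicator-mono-< {true}  {true}  _ a≢b = contradiction refl a≢b

sum-indicator-< : ∀ {n} (b : Fin n → Bool) i → b i ≡ false → sum (indicator ∘ b) < n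
sum-indicator-< {suc n} b i bi≡false = begin-strict
  sum (indicator ∘ b)                               ≡⟨ sum-remove (indicator ∘ b) ⟩
  indicator (b i) + sum (indicator ∘ b ∘ punchIn i) ≡⟨ cong (λ c → indicator c + sum (indicator ∘ b ∘ punchIn i)) bi≡false ⟩
  sum (indicator ∘ b ∘ punchIn i)                   ≤⟨ sum-mono-≤ {n} (indicator≤1 ∘ b ∘ punchIn i) ⟩
  sum {n} (λ _ → 1)                                 ≡⟨ sum-const {n} 1 ⟩
  n * 1                                             ≡⟨ *-identityʳ n ⟩
  n                                                 <⟨ n<1+n n ⟩
  suc n                                             ∎
  where open ≤-Reasoning

data Walk≤ (X : Graph) : ℕ → Fin (order X) → Fin (order X) → Set where
  []  : ∀ {k u} → Walk≤ X k u u
  _▷_ : ∀ {k u x w} → Walk≤ X k u x → T (adj X x w) → Walk≤ X (suc k) u w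

module _ {X : Graph} where

  Walk≤-mono : ∀ {k k′ u w} → k ≤ k′ → Walk≤ X k u w → Walk≤ X k′ u w
  Walk≤-mono _         []      = []
  Walk≤-mono (s≤s k≤k′) (p ▷ e) = Walk≤-mono k≤k′ p ▷ e

  infixr 5 _◁_
  _◁_ : ∀ {k u x w} → T (adj X u x) → Walk≤ X k x w → Walk≤ X (suc k) u w
  e ◁ []       = [] ▷ e
  e ◁ (p ▷ e′) = (e ◁ p) ▷ e′

  reverse : ∀ {k u w} → Walk≤ X k u w → Walk≤ X k w u
  reverse []                    = []
  reverse (_▷_ {x = x} {w} p e) = subst T (adj-sym X x w) e ◁ reverse p

  reach-complete : ∀ {k u w} → Walk≤ X k u w → T (reach X k u w)
  reach-complete {zero}  []      = fromWitness refl
  reach-complete {suc k} []      = Equivalence.from T-∨ (inj₁ (reach-complete {k} []))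
  reach-complete {suc k} (_▷_ {x = x} p e) =
    Equivalence.from T-∨ (inj₂ (any⁺ _ (lose (∈-allFin x) (Equivalence.from T-∧ (reach-complete p , e)))))

  reach-sound : ∀ k {u w} → T (reach X k u w) → Walk≤ X k u w
  reach-sound zero t with refl ← toWitness t = []
  reach-sound (suc k) t with Equivalence.to T-∨ t
  ... | inj₁ t′ = Walk≤-mono (n≤1+n k) (reach-sound k t′)
  ... | inj₂ t′ with _ , t″ ← satisfied (any⁻ (λ x → reach X k _ x ∧ adj X x _) (allFin _) t′)
                 with r , e ← Equivalence.to T-∧ t″ = reach-sound k r ▷ e

module _ (X : Graph) (u : Fin (order X)) where

  private
    reached : ℕ → Fin (order X) → Bool
    reached k = reach X k u

    #reached : ℕ → ℕ
    #reached k = sum (indicator ∘ reached k)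

    Stable : ℕ → Set
    Stable i = reached (suc i) ≗ reached i

  reach-suc-cong : ∀ {j k} → reached j ≗ reached k → reached (suc j) ≗ reached (suc k)
  reach-suc-cong j≗k w =
    cong₂ _∨_ (j≗k w) (cong or (map-cong (λ x → cong (_∧ adj X x w) (j≗k x)) (allFin (order X))))

  stable-forever : ∀ {i} → Stable i → ∀ d → reached (d + i) ≗ reached i
  stable-forever st zero    w = refl
  stable-forever {i} st (suc d) w = trans (reach-suc-cong {d + i} {i} (stable-forever st d) w) (st w)

  grows-or-stabilises : ∀ k → suc k ≤ #reached k ⊎ ∃[ i ] i ≤ k × Stable i
  grows-or-stabilises zero =
    inj₁ (≤-trans (indicator-mono (λ _ → reach-complete {X} {0} [])) (≤-sum (indicator ∘ reached 0) u))
  grows-or-stabilises (suc k) with grows-or-stabilises k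
  ... | inj₂ (i , i≤k , st) = inj₂ (i , m≤n⇒m≤1+n i≤k , st)
  ... | inj₁ grown with all? (λ w → reached (suc k) w ≟ᴮ reached k w)
  ...   | yes st = inj₂ (k , n≤1+n k , st)
  ...   | no ¬st with w , changed ← ¬∀⟶∃¬ _ _ (λ w → reached (suc k) w ≟ᴮ reached k w) ¬st =
    inj₁ (≤-trans (s≤s grown) (sum-mono-< (λ w → indicator-mono (widen w)) w
                                          (indicator-mono-< (widen w) (changed ∘ sym))))
    where
    widen : ∀ w → T (reached k w) → T (reached (suc k) w)
    widen w = reach-complete ∘ Walk≤-mono (n≤1+n k) ∘ reach-sound k

  -- The sets reached within k steps grow strictly until they stabilise, so they are all
  -- reached by step order X − 1.
  walk-shorten : ∀ {k w} → Walk≤ X k u w → Walk≤ X (pred (order X)) u w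
  walk-shorten {k} {w} p with grows-or-stabilises (pred (order X))
  ... | inj₂ (i , i≤ , st) =
    Walk≤-mono i≤ (reach-sound i (subst T (stable-forever st k w) (reach-complete (Walk≤-mono (m≤m+n k i) p))))
  ... | inj₁ full = reach-sound _ everything-reached
    where
    instance _ = nonZeroIndex u
    everything-reached : T (reached (pred (order X)) w)
    everything-reached with reached (pred (order X)) w in eq
    ... | true  = _
    ... | false = contradiction (subst (_≤ #reached (pred (order X))) (suc-pred (order X)) full)
                                (<⇒≱ (sum-indicator-< (reached (pred (order X))) w eq))

<∞-just-0 : ∀ a → (a <∞ just 0) ≡ false
<∞-just-0 (just zero)    = refl
<∞-just-0 (just (suc _)) = refl
<∞-just-0 nothing        = refl

<∞-shift : ∀ c a b → (Maybe.map (c +_) a <∞ Maybe.map (c +_) b) ≡ (a <∞ b)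
<∞-shift c (just x) (just y) = <ᵇ-shift c
  where
  <ᵇ-shift : ∀ c → (c + x <ᵇ c + y) ≡ (x <ᵇ y)
  <ᵇ-shift zero    = refl
  <ᵇ-shift (suc c) = <ᵇ-shift c
<∞-shift c (just x) nothing = refl
<∞-shift c nothing  b       = refl

IsDist : (X : Graph) → Fin (order X) → Fin (order X) → Maybe ℕ → Set
IsDist X u w (just d) = Walk≤ X d u w × (∀ {k} → Walk≤ X k u w → d ≤ k)
IsDist X u w nothing  = ∀ {k} → ¬ Walk≤ X k u w

module _ {X : Graph} where

  distFrom-isDist : ∀ {u w} k r → k + r ≡ order X → (∀ {j} → Walk≤ X j u w → k ≤ j) →
                    IsDist X u w (distFrom X k r u w)
  distFrom-isDist {u} k zero k≡n k≤ p = <-irrefl refl (begin-strict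
      order X       ≡⟨ trans (sym (+-identityʳ k)) k≡n ⟨
      k             <⟨ m≤pred[n]⇒suc[m]≤n (k≤ (walk-shorten X u p)) ⟩
      order X       ∎)
    where
    open ≤-Reasoning
    instance _ = nonZeroIndex u
  distFrom-isDist {u} {w} k (suc r) k+r≡n k≤ with reach X k u w in reached
  ... | true  = reach-sound k (subst T (sym reached) _) , k≤
  ... | false = distFrom-isDist (suc k) r (trans (sym (+-suc k r)) k+r≡n) k<
    where
    k< : ∀ {j} → Walk≤ X j u w → suc k ≤ j
    k< p with m≤n⇒m<n∨m≡n (k≤ p)
    ... | inj₁ k<j  = k<j
    ... | inj₂ refl = contradiction (subst T reached (reach-complete p)) id

  dist-isDist : ∀ u w → IsDist X u w (dist X u w)
  dist-isDist u w = distFrom-isDist 0 (order X) refl (λ _ → z≤n)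

  isDist-unique : ∀ {u w} r r′ → IsDist X u w r → IsDist X u w r′ → r ≡ r′
  isDist-unique (just d) (just d′) (p , d≤) (p′ , d′≤) = cong just (≤-antisym (d≤ p′) (d′≤ p))
  isDist-unique (just d) nothing   (p , _)  none       = contradiction p none
  isDist-unique nothing  (just d′) none     (p′ , _)   = contradiction p′ none
  isDist-unique nothing  nothing   _        _          = refl

  dist-refl : ∀ u → dist X u u ≡ just 0
  dist-refl u = isDist-unique _ _ (dist-isDist u u) ([] , λ _ → z≤n)

  dist-pos : ∀ {u w} → u ≢ w → T (just 0 <∞ dist X u w)
  dist-pos {u} {w} u≢w with dist X u w | dist-isDist u w
  ... | just zero    | [] , _ = u≢w refl
  ... | just (suc d) | _      = _
  ... | nothing      | _      = _

  isDist-shift : ∀ {Y : Graph} {u w u′ w′} c →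
                 (∀ {k} → Walk≤ X k u w → Walk≤ Y (c + k) u′ w′) →
                 (∀ {k} → Walk≤ Y k u′ w′ → ∃[ j ] c + j ≤ k × Walk≤ X j u w) →
                 ∀ {r} → IsDist X u w r → IsDist Y u′ w′ (Maybe.map (c +_) r)
  isDist-shift c lift lower {just d} (p , d≤) =
    lift p , λ p′ → let j , c+j≤k , q = lower p′ in ≤-trans (+-monoʳ-≤ c (d≤ q)) c+j≤k
  isDist-shift c lift lower {nothing} none p′ = none (proj₂ (proj₂ (lower p′)))

  nClose-sum : ∀ u v → nClose X u v ≡ sum (λ w → indicator (dist X w u <∞ dist X w v))
  nClose-sum u v = sum-allFin (λ w → indicator (dist X w u <∞ dist X w v))

  nClose-pos : ∀ {u v} → u ≢ v → 1 ≤ nClose X u v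
  nClose-pos {u} {v} u≢v = begin
    1                                                    ≤⟨ indicator-mono {true} (λ _ → u-closer) ⟩
    indicator (dist X u u <∞ dist X u v)                 ≤⟨ ≤-sum (λ w → indicator (dist X w u <∞ dist X w v)) u ⟩
    sum (λ w → indicator (dist X w u <∞ dist X w v))     ≡⟨ nClose-sum u v ⟨
    nClose X u v                                         ∎
    where
    open ≤-Reasoning
    u-closer : T (dist X u u <∞ dist X u v)
    u-closer = subst (λ d → T (d <∞ dist X u v)) (sym (dist-refl u)) (dist-pos u≢v)

  nClose<order : ∀ u v → nClose X u v < order X
  nClose<order u v = subst (_< order X) (sym (nClose-sum u v))
    (sum-indicator-< (λ w → dist X w u <∞ dist X w v) v
                     (trans (cong (dist X v u <∞_) (dist-refl v)) (<∞-just-0 (dist X v u))))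

∣-∣≤∸2 : ∀ {n a b} → 1 ≤ a → a < n → 1 ≤ b → b < n → ∣ a - b ∣ ≤ n ∸ 2
∣-∣≤∸2 {n} {a} {b} 1≤a a<n 1≤b b<n = [ bound a<n 1≤b , bound b<n 1≤a ]′ (∣m-n∣≡[m∸n]∨[n∸m] a b)
  where
  bound : ∀ {x y} → x < n → 1 ≤ y → ∣ a - b ∣ ≡ x ∸ y → ∣ a - b ∣ ≤ n ∸ 2
  bound x<n 1≤y eq = ≤-trans (≤-reflexive eq) (≤-trans (∸-mono (<⇒≤pred x<n) 1≤y) (≤-reflexive (∸-+-assoc n 1 1)))

∣nClose-nClose∣≤ : ∀ {X : Graph} {u v} → u ≢ v → ∣ nClose X u v - nClose X v u ∣ ≤ order X ∸ 2
∣nClose-nClose∣≤ {X} {u} {v} u≢v = ∣-∣≤∸2 (nClose-pos u≢v) (nClose<order u v) (nClose-pos (u≢v ∘ sym)) (nClose<order v u)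

mostarTerm : (X : Graph) → Fin (order X) → Fin (order X) → ℕ
mostarTerm X i j = if (toℕ i <ᵇ toℕ j) ∧ adj X i j then ∣ nClose X i j - nClose X j i ∣ else 0

mostar-sum : ∀ X → mostar X ≡ sum (λ i → sum (mostarTerm X i))
mostar-sum X = trans (sum-allFin (λ i → List.sum (map (mostarTerm X i) (allFin (order X)))))
                     (sum-cong-≗ (sum-allFin ∘ mostarTerm X))

mostarTerm-≤ : ∀ X i j → mostarTerm X i j ≤ (if adj X i j then order X ∸ 2 else 0)
mostarTerm-≤ X i j with toℕ i <ᵇ toℕ j | adj X i j in adjacent
... | false | _     = z≤n
... | true  | false = z≤n
... | true  | true  = ∣nClose-nClose∣≤ {X} λ { refl → case trans (sym adjacent) (adj-irrefl X i) of λ () }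

mostarTerm-≡0 : ∀ X i j → (T (toℕ i <ᵇ toℕ j) → T (adj X i j) → ⊥) → mostarTerm X i j ≡ 0
mostarTerm-≡0 X i j not-counted with toℕ i <ᵇ toℕ j | adj X i j
... | false | _     = refl
... | true  | false = refl
... | true  | true  = contradiction _ (not-counted _)

module Corona (G : Graph) (m : ℕ) where

  s : ℕ
  s = order G

  H : Graph
  H = coronaEmpty G m

  inner : Fin s → Fin (order H)
  inner g = g ↑ˡ (s * m)

  pendant : Fin (s * m) → Fin (order H)
  pendant p = s ↑ʳ p

  anchor : Fin s ⊎ Fin (s * m) → Fin s
  anchor (inj₁ g) = g
  anchor (inj₂ p) = quotient m p

  depth : Fin s ⊎ Fin (s * m) → ℕ
  depth (inj₁ _) = 0
  depth (inj₂ _) = 1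

  adjSplit : Fin s ⊎ Fin (s * m) → Fin s ⊎ Fin (s * m) → Bool
  adjSplit (inj₁ g) (inj₁ h) = adj G g h
  adjSplit (inj₁ g) (inj₂ q) = ⌊ g ≟ quotient m q ⌋
  adjSplit (inj₂ p) (inj₁ h) = ⌊ quotient m p ≟ h ⌋
  adjSplit (inj₂ p) (inj₂ q) = false

  adj-splitAt : ∀ x y → adj H x y ≡ adjSplit (splitAt s x) (splitAt s y)
  adj-splitAt x y with splitAt s x | splitAt s y
  ... | inj₁ _ | inj₁ _ = refl
  ... | inj₁ _ | inj₂ _ = refl
  ... | inj₂ _ | inj₁ _ = refl
  ... | inj₂ _ | inj₂ _ = refl

  adj-inner : ∀ g h → adj H (inner g) (inner h) ≡ adj G g h
  adj-inner g h rewrite adj-splitAt (inner g) (inner h) | splitAt-↑ˡ s g (s * m) | splitAt-↑ˡ s h (s * m) = refl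

  adj-inner-pendant : ∀ g q → adj H (inner g) (pendant q) ≡ ⌊ g ≟ quotient m q ⌋
  adj-inner-pendant g q rewrite adj-splitAt (inner g) (pendant q) | splitAt-↑ˡ s g (s * m) | splitAt-↑ʳ s (s * m) q = refl

  adj-pendant-inner : ∀ p h → adj H (pendant p) (inner h) ≡ ⌊ quotient m p ≟ h ⌋
  adj-pendant-inner p h rewrite adj-splitAt (pendant p) (inner h) | splitAt-↑ʳ s (s * m) p | splitAt-↑ˡ s h (s * m) = refl

  adj-pendant : ∀ p q → adj H (pendant p) (pendant q) ≡ false
  adj-pendant p q rewrite adj-splitAt (pendant p) (pendant q) | splitAt-↑ʳ s (s * m) p | splitAt-↑ʳ s (s * m) q = refl

  corona-edge : ∀ a b → T (adjSplit a b) →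
                (depth a ≡ 0 × depth b ≡ 0 × T (adj G (anchor a) (anchor b))) ⊎ anchor a ≡ anchor b
  corona-edge (inj₁ g) (inj₁ h) e = inj₁ (refl , refl , e)
  corona-edge (inj₁ g) (inj₂ q) e = inj₂ (toWitness e)
  corona-edge (inj₂ p) (inj₁ h) e = inj₂ (toWitness e)

  depth≤1 : ∀ a → depth a ≤ 1
  depth≤1 (inj₁ _) = z≤n
  depth≤1 (inj₂ _) = ≤-refl

  -- Inner edges are kept and pendant edges collapse onto their anchor.
  project : ∀ {k x y} → Walk≤ H k x y →
            ∃[ j ] Walk≤ G j (anchor (splitAt s x)) (anchor (splitAt s y))
                   × j + depth (splitAt s y) ≤ k + depth (splitAt s x)
  project {k} {x} [] = 0 , [] , +-monoˡ-≤ (depth (splitAt s x)) z≤n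
  project (_▷_ {k} {x} {z} {y} p e) with project p | corona-edge (splitAt s z) (splitAt s y) (subst T (adj-splitAt z y) e)
  ... | j , q , bound | inj₁ (dz≡0 , dy≡0 , e′) rewrite dz≡0 | dy≡0 = suc j , q ▷ e′ , s≤s bound
  ... | j , q , bound | inj₂ same = j , subst (Walk≤ G j _) same q , (begin
    j + depth (splitAt s y)       ≤⟨ +-monoʳ-≤ j (depth≤1 (splitAt s y)) ⟩
    j + 1                         ≡⟨ +-comm j 1 ⟩
    suc j                         ≤⟨ s≤s (m≤m+n j _) ⟩
    suc (j + depth (splitAt s z)) ≤⟨ s≤s bound ⟩
    suc (k + depth (splitAt s x)) ∎)
    where open ≤-Reasoning

  walk-inner : ∀ {k a b} → Walk≤ G k a b → Walk≤ H k (inner a) (inner b)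
  walk-inner []      = []
  walk-inner (_▷_ {x = x} {w} p e) = walk-inner p ▷ subst T (sym (adj-inner x w)) e

  walk-to-inner : ∀ v {k b} → Walk≤ G k (anchor v) b → Walk≤ H (depth v + k) (join s (s * m) v) (inner b)
  walk-to-inner (inj₁ g) q = walk-inner q
  walk-to-inner (inj₂ p) q = subst T (sym (adj-pendant-inner p (quotient m p))) (fromWitness refl) ◁ walk-inner q

  -- Reversed, the walk starts at an inner vertex, so project charges the full depth of v.
  walk-from-join : ∀ v {k b} → Walk≤ H k (join s (s * m) v) (inner b) →
                   ∃[ j ] depth v + j ≤ k × Walk≤ G j (anchor v) b
  walk-from-join v {k} {b} p with project (reverse p)
  ... | j , q , bound rewrite splitAt-↑ˡ s b (s * m) | splitAt-join s (s * m) v =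
    j , subst (_≤ k) (+-comm j (depth v)) (subst (j + depth v ≤_) (+-identityʳ k) bound) , reverse q

  dist-corona : ∀ v u → dist H (join s (s * m) v) (inner u) ≡ Maybe.map (depth v +_) (dist G (anchor v) u)
  dist-corona v u = isDist-unique _ _ (dist-isDist _ _)
                      (isDist-shift (depth v) (walk-to-inner v) (walk-from-join v) (dist-isDist (anchor v) u))

  closer-in-corona : ∀ v u w → (dist H (join s (s * m) v) (inner u) <∞ dist H (join s (s * m) v) (inner w))
                                ≡ (dist G (anchor v) u <∞ dist G (anchor v) w)
  closer-in-corona v u w = trans (cong₂ _<∞_ (dist-corona v u) (dist-corona v w))
                                 (<∞-shift (depth v) (dist G (anchor v) u) (dist G (anchor v) w))

  nClose-inner : ∀ u v → nClose H (inner u) (inner v) ≡ (m + 1) * nClose G u v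
  nClose-inner u v = begin
    nClose H (inner u) (inner v)                        ≡⟨ nClose-sum (inner u) (inner v) ⟩
    sum closerH                                         ≡⟨ sum-↑ s closerH ⟩
    sum (closerH ∘ inner) + sum (closerH ∘ pendant)     ≡⟨ cong₂ _+_ (sum-cong-≗ (λ g → cong indicator (closer-in-corona (inj₁ g) u v)))
                                                                    (sum-cong-≗ (λ p → cong indicator (closer-in-corona (inj₂ p) u v))) ⟩
    sum closerG + sum (closerG ∘ quotient m)            ≡⟨ cong (sum closerG +_) (sum-quotient s m closerG) ⟩
    sum closerG + m * sum closerG                       ≡⟨ cong (_* sum closerG) (+-comm m 1) ⟨
    (m + 1) * sum closerG                               ≡⟨ cong ((m + 1) *_) (nClose-sum u v) ⟨
    (m + 1) * nClose G u v                              ∎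
    where
    open ≡-Reasoning
    closerH : Fin (order H) → ℕ
    closerH x = indicator (dist H x (inner u) <∞ dist H x (inner v))
    closerG : Fin s → ℕ
    closerG w = indicator (dist G w u <∞ dist G w v)

  mostarTerm-inner : ∀ g h → mostarTerm H (inner g) (inner h) ≡ (m + 1) * mostarTerm G g h
  mostarTerm-inner g h = begin
    mostarTerm H (inner g) (inner h)
      ≡⟨ cong₂ (λ b d → if b then d else 0)
               (cong₂ _∧_ (cong₂ _<ᵇ_ (toℕ-↑ˡ g (s * m)) (toℕ-↑ˡ h (s * m))) (adj-inner g h))
               (cong₂ ∣_-_∣ (nClose-inner g h) (nClose-inner h g)) ⟩
    (if counted then ∣ (m + 1) * nClose G g h - (m + 1) * nClose G h g ∣ else 0)
      ≡⟨ cong (λ d → if counted then d else 0) (*-distribˡ-∣-∣ (m + 1) _ _) ⟨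
    (if counted then (m + 1) * ∣ nClose G g h - nClose G h g ∣ else 0)
      ≡⟨ if-cong-else counted (*-zeroʳ (m + 1)) ⟨
    (if counted then (m + 1) * ∣ nClose G g h - nClose G h g ∣ else (m + 1) * 0)
      ≡⟨ if-float ((m + 1) *_) counted ⟨
    (m + 1) * mostarTerm G g h
      ∎
    where
    open ≡-Reasoning
    counted : Bool
    counted = (toℕ g <ᵇ toℕ h) ∧ adj G g h

  inner<pendant : ∀ h p → toℕ (inner h) < toℕ (pendant p)
  inner<pendant h p = begin-strict
    toℕ (inner h)    ≡⟨ toℕ-↑ˡ h (s * m) ⟩
    toℕ h            <⟨ toℕ<n h ⟩
    s                ≤⟨ m≤m+n s (toℕ p) ⟩
    s + toℕ p        ≡⟨ toℕ-↑ʳ s p ⟨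
    toℕ (pendant p)  ∎
    where open ≤-Reasoning

  pendant-row : ∀ p → sum (mostarTerm H (pendant p)) ≡ 0
  pendant-row p = begin
    sum (mostarTerm H (pendant p))                                              ≡⟨ sum-↑ s (mostarTerm H (pendant p)) ⟩
    sum (mostarTerm H (pendant p) ∘ inner) + sum (mostarTerm H (pendant p) ∘ pendant)
      ≡⟨ cong₂ _+_ (sum-zero (λ h → mostarTerm-≡0 H _ _ (λ lt _ → <⇒≯ (inner<pendant h p) (<ᵇ⇒< _ _ lt))))
                   (sum-zero (λ q → mostarTerm-≡0 H _ _ (λ _ e → subst T (adj-pendant p q) e))) ⟩
    0 ∎
    where
    open ≡-Reasoning

  inner-row : ∀ g → sum (mostarTerm H (inner g)) ≤ (m + 1) * sum (mostarTerm G g) + m * (order H ∸ 2)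
  inner-row g = begin
    sum (mostarTerm H (inner g))
      ≡⟨ sum-↑ s (mostarTerm H (inner g)) ⟩
    sum (mostarTerm H (inner g) ∘ inner) + sum (mostarTerm H (inner g) ∘ pendant)
      ≤⟨ +-mono-≤ (≤-reflexive (sum-cong-≗ (mostarTerm-inner g))) (sum-mono-≤ pendant-edge) ⟩
    sum (λ h → (m + 1) * mostarTerm G g h) + sum (spoke ∘ quotient m)
      ≡⟨ cong (_+ sum (spoke ∘ quotient m)) (*-distribˡ-sum (m + 1) (mostarTerm G g)) ⟨
    (m + 1) * sum (mostarTerm G g) + sum (spoke ∘ quotient m)
      ≡⟨ cong ((m + 1) * sum (mostarTerm G g) +_) (trans (sum-quotient s m spoke) (cong (m *_) (sum-if-≟ g _))) ⟩
    (m + 1) * sum (mostarTerm G g) + m * (order H ∸ 2)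
      ∎
    where
    open ≤-Reasoning
    spoke : Fin s → ℕ
    spoke o = if ⌊ g ≟ o ⌋ then order H ∸ 2 else 0
    pendant-edge : ∀ q → mostarTerm H (inner g) (pendant q) ≤ spoke (quotient m q)
    pendant-edge q = subst (λ b → mostarTerm H (inner g) (pendant q) ≤ (if b then order H ∸ 2 else 0))
                           (adj-inner-pendant g q) (mostarTerm-≤ H (inner g) (pendant q))

  mostar-corona-≤ : mostar H ≤ (m + 1) * mostar G + s * m * (order H ∸ 2)
  mostar-corona-≤ = begin
    mostar H
      ≡⟨ mostar-sum H ⟩
    sum (λ x → sum (mostarTerm H x))
      ≡⟨ sum-↑ s (λ x → sum (mostarTerm H x)) ⟩
    sum (λ g → sum (mostarTerm H (inner g))) + sum (λ p → sum (mostarTerm H (pendant p)))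
      ≡⟨ cong (sum (λ g → sum (mostarTerm H (inner g))) +_) (sum-zero pendant-row) ⟩
    sum (λ g → sum (mostarTerm H (inner g))) + 0
      ≡⟨ +-identityʳ _ ⟩
    sum (λ g → sum (mostarTerm H (inner g)))
      ≤⟨ sum-mono-≤ inner-row ⟩
    sum (λ g → (m + 1) * sum (mostarTerm G g) + m * c)
      ≡⟨ ∑-distrib-+ (λ g → (m + 1) * sum (mostarTerm G g)) (λ _ → m * c) ⟩
    sum (λ g → (m + 1) * sum (mostarTerm G g)) + sum {s} (λ _ → m * c)
      ≡⟨ cong₂ _+_ (sym (*-distribˡ-sum (m + 1) (λ g → sum (mostarTerm G g)))) (sum-const {s} (m * c)) ⟩
    (m + 1) * sum (λ g → sum (mostarTerm G g)) + s * (m * c)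
      ≡⟨ cong₂ _+_ (cong ((m + 1) *_) (mostar-sum G)) (*-assoc s m c) ⟨
    (m + 1) * mostar G + s * m * c
      ∎
    where
    open ≤-Reasoning
    c : ℕ
    c = order H ∸ 2

corollary1 : (G : Graph) (m : ℕ) → 1 ≤ m →
    mostar (coronaEmpty G m)
      ≤ (m + 1) * mostar G + order G * m * ∣ 2 - (order G + order G * m) ∣
corollary1 G m _ = begin
  mostar H                           ≤⟨ mostar-corona-≤ ⟩
  (m + 1) * mostar G + s * m * (n ∸ 2) ≤⟨ +-monoʳ-≤ _ (*-monoʳ-≤ (s * m) (≤-trans (m∸n≤∣m-n∣ n 2) (≤-reflexive (∣-∣-comm n 2)))) ⟩
  (m + 1) * mostar G + s * m * ∣ 2 - n ∣ ∎
  where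
  open Corona G m
  open ≤-Reasoning
  n : ℕ
  n = order H
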